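{- Let $n\ge 1$ and let $\theta$ be a matching on $[2n]$ that avoids the pattern $12312$. Let $E_\theta=(j,2n)$ be the edge of $\theta$ containing the node $2n$, and suppose that at least one edge of $\theta$ crosses $E_\theta$. Let $F_\theta=(x,y)$ be, among the edges crossing $E_\theta$, the one with the rightmost end point. Then every node $v$ with $j<v<y$ is the end point (larger element) of its edge, the initial point of that edge lies strictly between $x$ and $j$, and the edges associated with the nodes strictly between $j$ and $y$ pairwise do not cross.
   Context: A matching on $[2n]=\{1,\dots,2n\}$ is a partition of $[2n]$ into $n$ blocks of size two (edges); an edge is written $(i,j)$ with $i<j$, $i$ its initial point and $j$ its end point. Two edges $(i,j)$ and $(i',j')$ cross if $i<i'<j<j'$ or $i'<i<j'<j$. The canonical sequential form of a matching with $n$ edges is the word of length $2n$ obtained by labeling the edges $1,\dots,n$ in increasing order of their initial points and writing, at each position $p\in[2n]$, the label of the edge containing $p$. Two words $a_1\cdots a_k$ and $b_1\cdots b_k$ are order-isomorphic if $a_i<a_j \iff b_i<b_j$ for all $i,j$. A matching contains a pattern (word) $\tau$ if its canonical sequential form has a subsequence order-isomorphic to $\tau$, and avoids $\tau$ otherwise. -}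

module Defs where

open import Data.Nat using (ℕ; zero; suc; _+_; _*_; _≤_; _<_; _<ᵇ_; _⊓_; _⊔_)
open import Data.Bool using (if_then_else_)
open import Data.Fin as Fin using (Fin)
open import Data.List using (List; length; lookup)
open import Data.Product using (Σ; _×_)
open import Data.Sum using (_⊎_)
open import Relation.Binary.PropositionalEquality using (_≡_; _≢_)
open import Relation.Nullary using (¬_)
open import Function.Bundles using (_⇔_)

-- A matching on [2n] = {1,…,2n} (1-based positions), given by the
-- partner map: a fixed-point-free involution of [2n].  Values of
-- `partner` outside [2n] are irrelevant.
record Matching (n : ℕ) : Set where
  field
    partner  : ℕ → ℕ
    inRange  : ∀ p → 1 ≤ p → p ≤ 2 * n → (1 ≤ partner p) × (partner p ≤ 2 * n)
    noFix    : ∀ p → 1 ≤ p → p ≤ 2 * n → partner p ≢ p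
    invol    : ∀ p → 1 ≤ p → p ≤ 2 * n → partner (partner p) ≡ p
open Matching public

IsEdge : ∀ {n} → Matching n → ℕ → ℕ → Set
IsEdge {n} θ a b = (1 ≤ a) × (a < b) × (b ≤ 2 * n) × (partner θ a ≡ b)

Cross : ℕ → ℕ → ℕ → ℕ → Set
Cross i j i' j' = ((i < i') × (i' < j) × (j < j')) ⊎ ((i' < i) × (i < j') × (j' < j))

countInit : ∀ {n} → Matching n → ℕ → ℕ
countInit θ zero = 0
countInit θ (suc m) = countInit θ m + (if suc m <ᵇ partner θ (suc m) then 1 else 0)

-- Canonical sequential form: letter at position p is the label of the edge
-- containing p, where edges are labelled 1,…,n by increasing initial point.
csf : ∀ {n} → Matching n → ℕ → ℕ
csf θ p = countInit θ (p ⊓ partner θ p)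

Contains : ∀ {n} → Matching n → List ℕ → Set
Contains {n} θ τ =
  Σ (Fin (length τ) → ℕ) λ ι →
    (∀ a → (1 ≤ ι a) × (ι a ≤ 2 * n)) ×
    (∀ a b → a Fin.< b → ι a < ι b) ×
    (∀ a b → (lookup τ a < lookup τ b) ⇔ (csf θ (ι a) < csf θ (ι b)))

Avoids : ∀ {n} → Matching n → List ℕ → Set
Avoids θ τ = ¬ Contains θ τ

edgeStart edgeEnd : ∀ {n} → Matching n → ℕ → ℕ
edgeStart θ v = v ⊓ partner θ v
edgeEnd θ v = v ⊔ partner θ v

module Submission where

-- Two crossing edges (a,d), (b,e), a < b < d < e, together with an edge opening at
-- some c with b < c < d, spell 12312.  Let (x,y) and (j,e) cross with x < j < y < e.
-- A node v with j < v < y cannot open an edge (take c = v).  So it closes an edge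
-- (p,v); p < x is excluded by the crossing (p,v), (x,y) with c = j, and j < p by the
-- previous point.  Two such closing edges (p,v), (q,w) cannot cross, again with c = j.

open import Defs
open import Data.Nat using (ℕ; suc; _≤_; _<_; _*_; _+_; _<ᵇ_; _⊓_; _≤′_; _<′_; ≤′-refl; ≤′-step; z≤n; s≤s; z<s)
open import Data.Nat.Properties
open import Data.Bool using (true)
open import Data.Fin as Fin using (Fin; toℕ)
open import Data.Fin.Properties using (toℕ≤pred[n])
open import Data.List using (List; _∷_; []; length; lookup)
open import Data.Product using (_×_; _,_; proj₁)
open import Data.Sum using (inj₁; inj₂)
open import Data.Empty using (⊥-elim)
open import Relation.Binary.PropositionalEquality
  using (_≡_; refl; sym; trans; cong; subst; subst₂)
open import Relation.Binary using (tri<; tri≈; tri>)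
open import Relation.Nullary using (¬_)
open import Function.Bundles using (_⇔_; mk⇔)

τ₁₂₃₁₂ : List ℕ
τ₁₂₃₁₂ = 1 ∷ 2 ∷ 3 ∷ 1 ∷ 2 ∷ []

StrictlyMonotone : (ℕ → ℕ) → Set
StrictlyMonotone f = ∀ {u v} → u < v → f u < f v

step⇒strictlyMonotone : ∀ f → (∀ u → f u < f (suc u)) → StrictlyMonotone f
step⇒strictlyMonotone f step u<v = go (<⇒<′ u<v)
  where
  go : ∀ {u v} → u <′ v → f u < f v
  go ≤′-refl      = step _
  go (≤′-step h) = <-trans (go h) (step _)

strictlyMonotone⇒monotone : ∀ {f} → StrictlyMonotone f → ∀ {u v} → u ≤ v → f u ≤ f v
strictlyMonotone⇒monotone mono u≤v with m≤n⇒m<n∨m≡n u≤v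
... | inj₁ u<v  = <⇒≤ (mono u<v)
... | inj₂ refl = ≤-refl

strictlyMonotone⇒<⇔< : ∀ {f} → StrictlyMonotone f → ∀ u v → (u < v) ⇔ (f u < f v)
strictlyMonotone⇒<⇔< {f} mono u v = mk⇔ mono reflect
  where
  reflect : f u < f v → u < v
  reflect fu<fv with <-cmp u v
  ... | tri< u<v _ _ = u<v
  ... | tri≈ _ refl _ = ⊥-elim (<-irrefl refl fu<fv)
  ... | tri> _ _ v<u = ⊥-elim (<-asym fu<fv (mono v<u))

contains-by-relabelling : ∀ {n} (θ : Matching n) (τ : List ℕ) (ι : Fin (length τ) → ℕ) {φ : ℕ → ℕ} →
  (∀ a → (1 ≤ ι a) × (ι a ≤ 2 * n)) → (∀ a b → a Fin.< b → ι a < ι b) →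
  StrictlyMonotone φ → (∀ a → csf θ (ι a) ≡ φ (lookup τ a)) → Contains θ τ
contains-by-relabelling θ τ ι bounds increasing mono letters = ι , bounds , increasing , iso
  where
  iso : ∀ a b → (lookup τ a < lookup τ b) ⇔ (csf θ (ι a) < csf θ (ι b))
  iso a b = subst₂ (λ c d → (lookup τ a < lookup τ b) ⇔ (c < d)) (sym (letters a)) (sym (letters b))
                   (strictlyMonotone⇒<⇔< mono (lookup τ a) (lookup τ b))

contains-12312 : ∀ {n} (θ : Matching n) {i₁ i₂ i₃ i₄ i₅} →
  1 ≤ i₁ → i₁ < i₂ → i₂ < i₃ → i₃ < i₄ → i₄ < i₅ → i₅ ≤ 2 * n →
  0 < csf θ i₁ → csf θ i₁ < csf θ i₂ → csf θ i₂ < csf θ i₃ →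
  csf θ i₄ ≡ csf θ i₁ → csf θ i₅ ≡ csf θ i₂ → Contains θ τ₁₂₃₁₂
contains-12312 {n} θ {i₁} {i₂} {i₃} {i₄} {i₅} 1≤i₁ i₁<i₂ i₂<i₃ i₃<i₄ i₄<i₅ i₅≤2n 0<c₁ c₁<c₂ c₂<c₃ c₄≡c₁ c₅≡c₂ =
  contains-by-relabelling θ τ₁₂₃₁₂ positionAt bounds (λ _ _ → position-mono)
    (step⇒strictlyMonotone letter letter-step) letters
  where
  position : ℕ → ℕ
  position 0 = i₁
  position 1 = i₂
  position 2 = i₃
  position 3 = i₄
  position 4 = i₅
  position (suc (suc (suc (suc (suc k))))) = suc k + i₅

  position-step : ∀ u → position u < position (suc u)
  position-step 0 = i₁<i₂
  position-step 1 = i₂<i₃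
  position-step 2 = i₃<i₄
  position-step 3 = i₄<i₅
  position-step 4 = m<n+m i₅ z<s
  position-step (suc (suc (suc (suc (suc k))))) = ≤-refl

  position-mono : StrictlyMonotone position
  position-mono = step⇒strictlyMonotone position position-step

  positionAt : Fin 5 → ℕ
  positionAt a = position (toℕ a)

  bounds : ∀ a → (1 ≤ positionAt a) × (positionAt a ≤ 2 * n)
  bounds a = ≤-trans 1≤i₁ (strictlyMonotone⇒monotone position-mono {v = toℕ a} z≤n)
           , ≤-trans (strictlyMonotone⇒monotone position-mono {v = 4} (toℕ≤pred[n] a)) i₅≤2n

  -- The relabelling must be strictly monotone on all of ℕ, which is why csf θ i₁ > 0 is needed.
  letter : ℕ → ℕ
  letter 0 = 0
  letter 1 = csf θ i₁
  letter 2 = csf θ i₂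
  letter (suc (suc (suc k))) = k + csf θ i₃

  letter-step : ∀ u → letter u < letter (suc u)
  letter-step 0 = 0<c₁
  letter-step 1 = c₁<c₂
  letter-step 2 = c₂<c₃
  letter-step (suc (suc (suc k))) = ≤-refl

  letters : ∀ a → csf θ (positionAt a) ≡ letter (lookup τ₁₂₃₁₂ a)
  letters Fin.zero = refl
  letters (Fin.suc Fin.zero) = refl
  letters (Fin.suc (Fin.suc Fin.zero)) = refl
  letters (Fin.suc (Fin.suc (Fin.suc Fin.zero))) = c₄≡c₁
  letters (Fin.suc (Fin.suc (Fin.suc (Fin.suc Fin.zero)))) = c₅≡c₂

IsInitial : ∀ {n} → Matching n → ℕ → Set
IsInitial θ q = q < partner θ q

module MatchingFacts {n} (θ : Matching n) where

  countInit-mono : ∀ {m k} → m ≤ k → countInit θ m ≤ countInit θ k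
  countInit-mono m≤k = go (≤⇒≤′ m≤k)
    where
    go : ∀ {m k} → m ≤′ k → countInit θ m ≤ countInit θ k
    go ≤′-refl      = ≤-refl
    go (≤′-step h) = ≤-trans (go h) (m≤m+n _ _)

  countInit-<-initial : ∀ {q q′} → q < q′ → IsInitial θ q′ → countInit θ q < countInit θ q′
  countInit-<-initial {q} {suc m} (s≤s q≤m) initial with suc m <ᵇ partner θ (suc m) | <⇒<ᵇ initial
  ... | true | _ = ≤-<-trans (countInit-mono q≤m) (m<m+n _ z<s)

  csf-initial : ∀ {q} → IsInitial θ q → csf θ q ≡ countInit θ q
  csf-initial initial = cong (countInit θ) (m≤n⇒m⊓n≡m (<⇒≤ initial))

  csf-<-initial : ∀ {q q′} → q < q′ → IsInitial θ q → IsInitial θ q′ → csf θ q < csf θ q′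
  csf-<-initial q<q′ initial initial′ =
    subst₂ _<_ (sym (csf-initial initial)) (sym (csf-initial initial′)) (countInit-<-initial q<q′ initial′)

  csf-initial-positive : ∀ {q} → 0 < q → IsInitial θ q → 0 < csf θ q
  csf-initial-positive 0<q initial = subst (0 <_) (sym (csf-initial initial)) (countInit-<-initial 0<q initial)

  csf-partner : ∀ {p} → 1 ≤ p → p ≤ 2 * n → csf θ (partner θ p) ≡ csf θ p
  csf-partner {p} 1≤p p≤2n =
    cong (countInit θ) (trans (cong (partner θ p ⊓_) (invol θ p 1≤p p≤2n)) (⊓-comm (partner θ p) p))

  edge-initial : ∀ {a b} → IsEdge θ a b → IsInitial θ a
  edge-initial (_ , a<b , _ , pa≡b) = subst (_ <_) (sym pa≡b) a<b

  csf-edge : ∀ {a b} → IsEdge θ a b → csf θ b ≡ csf θ a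
  csf-edge (1≤a , a<b , b≤2n , pa≡b) = subst (λ b → csf θ b ≡ _) pa≡b (csf-partner 1≤a (≤-trans (<⇒≤ a<b) b≤2n))

  edge-end-unique : ∀ {a a′ b b′} → a ≡ a′ → IsEdge θ a b → IsEdge θ a′ b′ → b ≡ b′
  edge-end-unique refl (_ , _ , _ , pa≡b) (_ , _ , _ , pa≡b′) = trans (sym pa≡b) pa≡b′

  inside-edge-range : ∀ {x y v} → IsEdge θ x y → x < v → v < y → (1 ≤ v) × (v ≤ 2 * n)
  inside-edge-range (1≤x , _ , y≤2n , _) x<v v<y = ≤-trans 1≤x (<⇒≤ x<v) , ≤-trans (<⇒≤ v<y) y≤2n

  closer-edge : ∀ {v} → 1 ≤ v → v ≤ 2 * n → partner θ v < v → IsEdge θ (partner θ v) v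
  closer-edge 1≤v v≤2n pv<v = proj₁ (inRange θ _ 1≤v v≤2n) , pv<v , v≤2n , invol θ _ 1≤v v≤2n

  closer-edgeStart : ∀ {v} → partner θ v < v → edgeStart θ v ≡ partner θ v
  closer-edgeStart pv<v = m≥n⇒m⊓n≡n (<⇒≤ pv<v)

  closer-edgeEnd : ∀ {v} → partner θ v < v → edgeEnd θ v ≡ v
  closer-edgeEnd pv<v = m≥n⇒m⊔n≡m (<⇒≤ pv<v)

  crossing-initial⇒12312 : ∀ {a b c d e} → IsEdge θ a d → IsEdge θ b e →
    a < b → b < c → c < d → d < e → IsInitial θ c → Contains θ τ₁₂₃₁₂
  crossing-initial⇒12312 ad@(1≤a , _) be@(_ , _ , e≤2n , _) a<b b<c c<d d<e c-initial =
    contains-12312 θ 1≤a a<b b<c c<d d<e e≤2n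
      (csf-initial-positive 1≤a (edge-initial ad))
      (csf-<-initial a<b (edge-initial ad) (edge-initial be))
      (csf-<-initial b<c (edge-initial be) c-initial)
      (csf-edge ad) (csf-edge be)

module _ {n} {θ : Matching n} (avoids : Avoids θ τ₁₂₃₁₂) where

  open MatchingFacts θ

  closers-over-initial-not-crossing : ∀ {j a v b w} → IsInitial θ j → IsEdge θ a v → IsEdge θ b w →
    a < j → j < v → b < j → j < w → ¬ Cross a v b w
  closers-over-initial-not-crossing j-initial av bw a<j j<v b<j j<w (inj₁ (a<b , b<v , v<w)) =
    avoids (crossing-initial⇒12312 av bw a<b b<j j<v v<w j-initial)
  closers-over-initial-not-crossing j-initial av bw a<j j<v b<j j<w (inj₂ (b<a , a<w , w<v)) =
    avoids (crossing-initial⇒12312 bw av b<a a<j j<w w<v j-initial)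

  module _ {x y j e} (xy : IsEdge θ x y) (je : IsEdge θ j e) (x<j : x < j) (j<y : j < y) (y<e : y < e) where

    no-initial-inside-crossing : ∀ {v} → j < v → v < y → ¬ IsInitial θ v
    no-initial-inside-crossing j<v v<y v-initial =
      avoids (crossing-initial⇒12312 xy je x<j j<v v<y y<e v-initial)

    start-inside-crossing : ∀ {p v} → IsEdge θ p v → j < v → v < y → (x < p) × (p < j)
    start-inside-crossing {p} pv@(_ , p<v , _) j<v v<y with <-cmp p x
    ... | tri< p<x _ _ = ⊥-elim (avoids (crossing-initial⇒12312 pv xy p<x x<j j<v v<y (edge-initial je)))
    ... | tri≈ _ p≡x _ = ⊥-elim (<⇒≢ v<y (edge-end-unique p≡x pv xy))
    ... | tri> _ _ x<p with <-cmp p j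
    ...   | tri< p<j _ _ = x<p , p<j
    ...   | tri≈ _ p≡j _ = ⊥-elim (<⇒≢ (<-trans v<y y<e) (edge-end-unique p≡j pv je))
    ...   | tri> _ _ j<p = ⊥-elim (no-initial-inside-crossing j<p (<-trans p<v v<y) (edge-initial pv))

    closer-inside-crossing : ∀ {v} → j < v → v < y →
      (partner θ v < v) × (x < partner θ v) × (partner θ v < j)
    closer-inside-crossing {v} j<v v<y with inside-edge-range xy (<-trans x<j j<v) v<y | <-cmp (partner θ v) v
    ... | 1≤v , v≤2n | tri< pv<v _ _ = pv<v , start-inside-crossing (closer-edge 1≤v v≤2n pv<v) j<v v<y
    ... | 1≤v , v≤2n | tri≈ _ pv≡v _ = ⊥-elim (noFix θ v 1≤v v≤2n pv≡v)
    ... | _          | tri> _ _ v<pv = ⊥-elim (no-initial-inside-crossing j<v v<y v<pv)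

    closer-edge-inside-crossing : ∀ {v} → j < v → v < y → IsEdge θ (partner θ v) v
    closer-edge-inside-crossing j<v v<y with inside-edge-range xy (<-trans x<j j<v) v<y
    ... | 1≤v , v≤2n = closer-edge 1≤v v≤2n (proj₁ (closer-inside-crossing j<v v<y))

    closers-inside-crossing-not-crossing : ∀ {v w} → j < v → v < y → j < w → w < y →
      ¬ Cross (edgeStart θ v) (edgeEnd θ v) (edgeStart θ w) (edgeEnd θ w)
    closers-inside-crossing-not-crossing j<v v<y j<w w<y
      with closer-inside-crossing j<v v<y | closer-inside-crossing j<w w<y
    ... | pv<v , _ , pv<j | pw<w , _ , pw<j
      rewrite closer-edgeStart pv<v | closer-edgeEnd pv<v | closer-edgeStart pw<w | closer-edgeEnd pw<w =
      closers-over-initial-not-crossing (edge-initial je)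
        (closer-edge-inside-crossing j<v v<y) (closer-edge-inside-crossing j<w w<y) pv<j j<v pw<j j<w

crossing-from-left : ∀ {x y j N} → y ≤ N → Cross x y j N → (x < j) × (j < y) × (y < N)
crossing-from-left y≤N (inj₁ x<j<y<N) = x<j<y<N
crossing-from-left y≤N (inj₂ (_ , _ , N<y)) = ⊥-elim (<-irrefl refl (<-≤-trans N<y y≤N))

lemma1 : (n : ℕ) → 1 ≤ n → (θ : Matching n) →
    Avoids θ (1 ∷ 2 ∷ 3 ∷ 1 ∷ 2 ∷ []) →
    (j : ℕ) → IsEdge θ j (2 * n) →
    (x y : ℕ) → IsEdge θ x y → Cross x y j (2 * n) →
    (∀ a b → IsEdge θ a b → Cross a b j (2 * n) → b ≤ y) →
    (∀ v → j < v → v < y →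
       (partner θ v < v) × (x < partner θ v) × (partner θ v < j)) ×
    (∀ v w → j < v → v < y → j < w → w < y →
       ¬ Cross (edgeStart θ v) (edgeEnd θ v) (edgeStart θ w) (edgeEnd θ w))
lemma1 n _ θ avoids j j2n x y xy@(_ , _ , y≤2n , _) crossing _
  with crossing-from-left y≤2n crossing
... | x<j , j<y , y<2n =
  (λ v j<v v<y → closer-inside-crossing avoids xy j2n x<j j<y y<2n j<v v<y) ,
  (λ v w j<v v<y j<w w<y → closers-inside-crossing-not-crossing avoids xy j2n x<j j<y y<2n j<v v<y j<w w<y)
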